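{- Let $\Gamma$ be a connected bipartite graph of valency $r\ge 3$, let $X\le\mathrm{Aut}(\Gamma)$, and suppose $\Gamma$ is $(X,2)$-distance transitive. Suppose that for a vertex $u\in V(\Gamma)$ the stabilizer $X_u$ acts regularly on the neighbourhood $\Gamma(u)$ of $u$. Then $\Gamma\cong K_{r,r}$ or $\Gamma\cong K_{r+1,r+1}-(r+1)K_2$.
   Context: All graphs are finite, simple, undirected. $\Gamma$ is $(X,2)$-distance transitive if $X$ is transitive on $V(\Gamma)$ and for every vertex $u$, $X_u$ is transitive on the set of vertices at distance $1$ from $u$ and on the set of vertices at distance $2$ from $u$. $K_{m,m}-mK_2$ denotes the complete bipartite graph $K_{m,m}$ with a perfect matching removed. -}

module Defs where

open import Data.Nat using (ℕ; zero; suc; _+_; _<_; _≤_)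
open import Data.Bool using (Bool; true; false; _∧_; not)
open import Data.Fin using (Fin; splitAt)
open import Data.Fin.Properties using () renaming (_≟_ to _≟ᶠ_)
open import Data.Fin.Permutation using (Permutation′; _⟨$⟩ʳ_; id; flip; _∘ₚ_)
open import Data.List using (List; length; filterᵇ; allFin)
open import Data.Sum using (_⊎_; inj₁; inj₂)
open import Data.Product using (Σ; _×_; ∃; _,_)
open import Relation.Binary.PropositionalEquality using (_≡_; _≢_)
open import Relation.Nullary using (¬_; does)
open import Function.Bundles using (_↔_; Inverse)

record Graph (n : ℕ) : Set where
  field
    adj    : Fin n → Fin n → Bool
    sym    : ∀ u v → adj u v ≡ adj v u
    irrefl : ∀ u → adj u u ≡ false
open Graph public

module _ {n : ℕ} (Γ : Graph n) where

  Adj : Fin n → Fin n → Set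
  Adj u v = adj Γ u v ≡ true

  degree : Fin n → ℕ
  degree u = length (filterᵇ (adj Γ u) (allFin n))

  Regular : ℕ → Set
  Regular r = ∀ u → degree u ≡ r

  data Walk : ℕ → Fin n → Fin n → Set where
    here  : ∀ {u} → Walk zero u u
    there : ∀ {k u v w} → Adj u v → Walk k v w → Walk (suc k) u w

  Dist : ℕ → Fin n → Fin n → Set
  Dist k u v = Walk k u v × (∀ m → m < k → ¬ Walk m u v)

  Connected : Set
  Connected = ∀ u v → ∃ λ k → Walk k u v

  Bipartite : Set
  Bipartite = Σ (Fin n → Bool) λ c → ∀ u v → Adj u v → c u ≢ c v

  IsAut : Permutation′ n → Set
  IsAut g = ∀ u v → adj Γ (g ⟨$⟩ʳ u) (g ⟨$⟩ʳ v) ≡ adj Γ u v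

  record AutSubgroup : Set₁ where
    field
      Mem     : Permutation′ n → Set
      mem-aut : ∀ {g} → Mem g → IsAut g
      mem-ext : ∀ {g h} → Mem g → (∀ x → g ⟨$⟩ʳ x ≡ h ⟨$⟩ʳ x) → Mem h
      mem-id  : Mem id
      mem-∘   : ∀ {g h} → Mem g → Mem h → Mem (g ∘ₚ h)
      mem-inv : ∀ {g} → Mem g → Mem (flip g)

  module _ (X : AutSubgroup) where
    open AutSubgroup X

    VertexTransitive : Set
    VertexTransitive = ∀ u v → Σ (Permutation′ n) λ g → Mem g × g ⟨$⟩ʳ u ≡ v

    StabTransitiveAt : ℕ → Fin n → Set
    StabTransitiveAt k u = ∀ v w → Dist k u v → Dist k u w →
      Σ (Permutation′ n) λ g → Mem g × g ⟨$⟩ʳ u ≡ u × g ⟨$⟩ʳ v ≡ w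

    DistanceTransitive2 : Set
    DistanceTransitive2 =
      VertexTransitive × (∀ u → StabTransitiveAt 1 u) × (∀ u → StabTransitiveAt 2 u)

    StabRegularOnNbhd : Fin n → Set
    StabRegularOnNbhd u =
      (∀ v w → Adj u v → Adj u w →
         Σ (Permutation′ n) λ g → Mem g × g ⟨$⟩ʳ u ≡ u × g ⟨$⟩ʳ v ≡ w)
      × (∀ g v → Mem g → g ⟨$⟩ʳ u ≡ u → Adj u v → g ⟨$⟩ʳ v ≡ v →
           ∀ x → g ⟨$⟩ʳ x ≡ x)

_≅_ : ∀ {n m} → Graph n → Graph m → Set
_≅_ {n} {m} G H = Σ (Fin n ↔ Fin m) λ f →
  ∀ u v → adj H (Inverse.to f u) (Inverse.to f v) ≡ adj G u v

-- K_{m,m} and K_{m,m} - mK_2 on vertex set Fin (m + m):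
-- vertex i < m is (0,i), vertex m + j is (1,j).

private
  kAdj : ∀ m → Fin (m + m) → Fin (m + m) → Bool
  kAdj m x y with splitAt m x | splitAt m y
  ... | inj₁ _ | inj₂ _ = true
  ... | inj₂ _ | inj₁ _ = true
  ... | _      | _      = false

  kmAdj : ∀ m → Fin (m + m) → Fin (m + m) → Bool
  kmAdj m x y with splitAt m x | splitAt m y
  ... | inj₁ i | inj₂ j = not (does (i ≟ᶠ j))
  ... | inj₂ i | inj₁ j = not (does (i ≟ᶠ j))
  ... | _      | _      = false

  kSym : ∀ m x y → kAdj m x y ≡ kAdj m y x
  kSym m x y with splitAt m x | splitAt m y
  ... | inj₁ _ | inj₁ _ = Relation.Binary.PropositionalEquality.refl
  ... | inj₁ _ | inj₂ _ = Relation.Binary.PropositionalEquality.refl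
  ... | inj₂ _ | inj₁ _ = Relation.Binary.PropositionalEquality.refl
  ... | inj₂ _ | inj₂ _ = Relation.Binary.PropositionalEquality.refl

  kIrr : ∀ m x → kAdj m x x ≡ false
  kIrr m x with splitAt m x
  ... | inj₁ _ = Relation.Binary.PropositionalEquality.refl
  ... | inj₂ _ = Relation.Binary.PropositionalEquality.refl

  notDoes-sym : ∀ {k} (i j : Fin k) → not (does (i ≟ᶠ j)) ≡ not (does (j ≟ᶠ i))
  notDoes-sym i j with i ≟ᶠ j | j ≟ᶠ i
  ... | Relation.Nullary.yes _ | Relation.Nullary.yes _ = Relation.Binary.PropositionalEquality.refl
  ... | Relation.Nullary.no _  | Relation.Nullary.no _  = Relation.Binary.PropositionalEquality.refl
  ... | Relation.Nullary.yes p | Relation.Nullary.no ¬q = Data.Empty.⊥-elim (¬q (Relation.Binary.PropositionalEquality.sym p))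
    where import Data.Empty
  ... | Relation.Nullary.no ¬p | Relation.Nullary.yes q = Data.Empty.⊥-elim (¬p (Relation.Binary.PropositionalEquality.sym q))
    where import Data.Empty

  kmSym : ∀ m x y → kmAdj m x y ≡ kmAdj m y x
  kmSym m x y with splitAt m x | splitAt m y
  ... | inj₁ _ | inj₁ _ = Relation.Binary.PropositionalEquality.refl
  ... | inj₁ i | inj₂ j = notDoes-sym i j
  ... | inj₂ i | inj₁ j = notDoes-sym i j
  ... | inj₂ _ | inj₂ _ = Relation.Binary.PropositionalEquality.refl

  kmIrr : ∀ m x → kmAdj m x x ≡ false
  kmIrr m x with splitAt m x
  ... | inj₁ _ = Relation.Binary.PropositionalEquality.refl
  ... | inj₂ _ = Relation.Binary.PropositionalEquality.refl

Kmm : ∀ m → Graph (m + m)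
Kmm m = record { adj = kAdj m ; sym = kSym m ; irrefl = kIrr m }

KminusMatching : ∀ m → Graph (m + m)
KminusMatching m = record { adj = kmAdj m ; sym = kmSym m ; irrefl = kmIrr m }

-- Arc stabilisers X_{yv} are conjugate to X_{uv} = 1, so X_y, being transitive on Γ₂(y), has |Γ₂(y)| ≤ r.
-- Each neighbour of u has r - 1 neighbours in Γ₂(u), and all w ∈ Γ₂(u) have the same number c of common
-- neighbours with u; counting the edges between Γ(u) and Γ₂(u) gives r (r - 1) = |Γ₂(u)| c, which together
-- with |Γ₂(u)|, c ≤ r leaves (|Γ₂(u)|, c) = (r - 1, r) or (r, r - 1).
-- In the first case Γ(w) = Γ(u) for all w ∈ Γ₂(u), so V = {u} ∪ Γ(u) ∪ Γ₂(u).
-- In the second case, since r ≥ 3 any two vertices of Γ₂(u) have a common neighbour in Γ(u), so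
-- Γ₂(w) = {u} ∪ (Γ₂(u) ∖ {w}) by |Γ₂(w)| ≤ r; hence the unique neighbour of w outside Γ(u) is adjacent to all
-- of Γ₂(u), is the same vertex ξ for every w, and V = {u} ∪ Γ(u) ∪ Γ₂(u) ∪ {ξ}.
-- In both cases the colour class of u is {u} ∪ Γ₂(u), and an r-regular bipartite graph whose colour classes
-- have r (resp. r + 1) vertices is K_{r,r} (resp. K_{r+1,r+1} - (r + 1) K₂).

module Submission where

open import Defs renaming (sym to adj-sym)
open import Data.Bool using (Bool; true; false; not; _∧_; _∨_; _xor_; if_then_else_)
import Data.Bool.Properties as Bool
open import Data.Empty.Irrelevant using (⊥-elim)
open import Data.Fin using (Fin; zero; suc; splitAt; join)
open import Data.Fin.Permutation using (Permutation′; _⟨$⟩ʳ_; _⟨$⟩ˡ_; flip; _∘ₚ_; inverseˡ; inverseʳ)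
open import Data.Fin.Properties using (_≟_; any?; injective⇒≤; splitAt-join; join-splitAt)
open import Data.List using (length; filterᵇ; tabulate)
open import Data.Nat using (ℕ; zero; suc; _+_; _*_; _≤_; _<_; z≤n; s≤s; NonZero)
open import Data.Nat.Properties
  using (+-0-commutativeMonoid; +-comm; *-comm; +-monoʳ-≤; *-mono-≤; *-monoʳ-<; +-cancelˡ-≡; *-cancelʳ-≡;
         ≤-trans; ≤-reflexive; ≤-pred; <-irrefl; <⇒≱; n<1+n; m<m+n; m≤n⇒m<n∨m≡n; suc-injective; module ≤-Reasoning)
open import Algebra.Properties.CommutativeMonoid.Sum +-0-commutativeMonoid
  using (sum; sum-cong-≗; ∑-distrib-+; ∑-comm; sum-permute)
open import Data.Product using (Σ; ∃; _×_; _,_; proj₁; proj₂; uncurry)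
open import Data.Sum using (_⊎_; inj₁; inj₂; [_,_]′; map; map₂; reduce)
open import Function.Base using (id; _∘_; const)
open import Function.Bundles using (_↔_; _⇔_; Inverse; mk↔ₛ′; mk⇔)
open import Function.Construct.Composition using (_⇔-∘_)
open import Relation.Binary.PropositionalEquality
open import Relation.Nullary using (¬_; Dec; yes; no; does; _×-dec_; contradiction)
open import Relation.Nullary.Decidable using (dec-true; dec-false; does-⇔)

private
  variable
    m n a b s : ℕ

∨-true⁻ : ∀ {p q} → p ∨ q ≡ true → p ≡ true ⊎ q ≡ true
∨-true⁻ {true}  _ = inj₁ refl
∨-true⁻ {false} q = inj₂ q

∨-true⁺ʳ : ∀ p {q} → q ≡ true → p ∨ q ≡ true
∨-true⁺ʳ p refl = Bool.∨-zeroʳ p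

does-true⁻ : ∀ {a} {A : Set a} (a? : Dec A) → does a? ≡ true → A
does-true⁻ (yes a) _ = a

xor-true⇒≡not : ∀ {a b} → a xor b ≡ true → b ≡ not a
xor-true⇒≡not {true}  p = Bool.not-injective p
xor-true⇒≡not {false} p = p

infix 4 _⊆_
_⊆_ : (P Q : Fin n → Bool) → Set
P ⊆ Q = ∀ x → P x ≡ true → Q x ≡ true

indicator : Bool → ℕ
indicator b = if b then 1 else 0

count : (Fin n → Bool) → ℕ
count P = sum (indicator ∘ P)

count-cong : {P Q : Fin n → Bool} → (∀ x → P x ≡ Q x) → count P ≡ count Q
count-cong P≗Q = sum-cong-≗ (cong indicator ∘ P≗Q)

count-permute : (P : Fin n → Bool) (π : Permutation′ n) → count (P ∘ (π ⟨$⟩ʳ_)) ≡ count P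
count-permute P π = sym (sum-permute (indicator ∘ P) π)

count-+ : (R P Q : Fin n → Bool) →
  (∀ x → indicator (R x) ≡ indicator (P x) + indicator (Q x)) →
  count R ≡ count P + count Q
count-+ R P Q pointwise = trans (sum-cong-≗ pointwise) (∑-distrib-+ (indicator ∘ P) (indicator ∘ Q))

count-split : (P Q : Fin n → Bool) →
  count P ≡ count (λ x → P x ∧ Q x) + count (λ x → P x ∧ not (Q x))
count-split P Q = count-+ _ _ _ pointwise
  where
  pointwise : ∀ x → indicator (P x) ≡ indicator (P x ∧ Q x) + indicator (P x ∧ not (Q x))
  pointwise x with P x | Q x
  ... | true  | true  = refl
  ... | true  | false = refl
  ... | false | _     = refl

count-∨-disjoint : (P Q : Fin n → Bool) → (∀ x → P x ≡ true → Q x ≡ false) →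
  count (λ x → P x ∨ Q x) ≡ count P + count Q
count-∨-disjoint P Q disjoint = count-+ _ _ _ pointwise
  where
  pointwise : ∀ x → indicator (P x ∨ Q x) ≡ indicator (P x) + indicator (Q x)
  pointwise x with P x in p | Q x in q
  ... | false | _ = refl
  ... | true  | false = refl
  ... | true  | true with () ← trans (sym q) (disjoint x p)

count-const-false : count {n} (λ _ → false) ≡ 0
count-const-false {zero}  = refl
count-const-false {suc n} = count-const-false {n}

count-none : {P : Fin n → Bool} → (∀ x → P x ≢ true) → count P ≡ 0
count-none {n} none = trans (count-cong (λ x → Bool.¬-not (none x))) (count-const-false {n})

count-singleton : (x : Fin n) → count (λ y → does (y ≟ x)) ≡ 1
count-singleton {suc n} zero    = cong suc (count-const-false {n})
count-singleton {suc n} (suc x) = count-singleton x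

sum-indicator* : (P : Fin n → Bool) (a : ℕ) → sum (λ x → if P x then a else 0) ≡ count P * a
sum-indicator* {zero}  P a = refl
sum-indicator* {suc n} P a with P zero
... | true  = cong (a +_) (sum-indicator* (P ∘ suc) a)
... | false = sum-indicator* (P ∘ suc) a

count-double : (R : Fin m → Fin n → Bool) (P : Fin m → Bool) (Q : Fin n → Bool) →
  (∀ x → count (R x) ≡ (if P x then a else 0)) →
  (∀ y → count (λ x → R x y) ≡ (if Q y then b else 0)) →
  count P * a ≡ count Q * b
count-double {a = a} {b = b} R P Q rows columns = begin
  count P * a                                ≡⟨ sum-indicator* P a ⟨
  sum (λ x → if P x then a else 0)           ≡⟨ sum-cong-≗ rows ⟨
  sum (λ x → sum (λ y → indicator (R x y)))  ≡⟨ ∑-comm (λ x y → indicator (R x y)) ⟩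
  sum (λ y → sum (λ x → indicator (R x y)))  ≡⟨ sum-cong-≗ columns ⟩
  sum (λ y → if Q y then b else 0)           ≡⟨ sum-indicator* Q b ⟩
  count Q * b                                ∎
  where open ≡-Reasoning

record Enumeration (P : Fin n → Bool) (a : ℕ) : Set where
  field
    element       : Fin a → Fin n
    index         : ∀ x → .(P x ≡ true) → Fin a
    element∈      : ∀ i → P (element i) ≡ true
    index-element : ∀ i → index (element i) (element∈ i) ≡ i
    element-index : ∀ x .(p : P x ≡ true) → element (index x p) ≡ x

  index-cong : ∀ {x y} → x ≡ y → .(p : P x ≡ true) .(q : P y ≡ true) → index x p ≡ index y q
  index-cong refl _ _ = refl

  element-injective : ∀ {i j} → element i ≡ element j → i ≡ j
  element-injective {i} {j} eq = begin
    i                               ≡⟨ index-element i ⟨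
    index (element i) (element∈ i)  ≡⟨ index-cong eq (element∈ i) (element∈ j) ⟩
    index (element j) (element∈ j)  ≡⟨ index-element j ⟩
    j                               ∎
    where open ≡-Reasoning

  index-injective : ∀ {x y} .{p : P x ≡ true} .{q : P y ≡ true} → index x p ≡ index y q → x ≡ y
  index-injective {x} {y} {p} {q} eq =
    trans (sym (element-index x p)) (trans (cong element eq) (element-index y q))

  index-≡⇔ : ∀ {x y} .{p : P x ≡ true} .{q : P y ≡ true} → index x p ≡ index y q ⇔ x ≡ y
  index-≡⇔ {x} {y} {p} {q} = mk⇔ index-injective (λ x≡y → index-cong x≡y p q)

enumerate : (P : Fin n → Bool) → Enumeration P (count P)
enumerate {zero}  P = record
  { element = λ () ; index = λ () ; element∈ = λ () ; index-element = λ () ; element-index = λ () }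
enumerate {suc n} P with P zero in P0 | enumerate (P ∘ suc)
... | true  | E = record
  { element = λ { zero → zero ; (suc i) → suc (element i) }
  ; index = λ { zero _ → zero ; (suc x) p → suc (index x p) }
  ; element∈ = λ { zero → P0 ; (suc i) → element∈ i }
  ; index-element = λ { zero → refl ; (suc i) → cong suc (index-element i) }
  ; element-index = λ { zero _ → refl ; (suc x) p → cong suc (element-index x p) }
  }
  where open Enumeration E
... | false | E = record
  { element = suc ∘ element
  ; index = λ { zero p → ⊥-elim (Bool.not-¬ P0 p) ; (suc x) p → index x p }
  ; element∈ = element∈
  ; index-element = index-element
  ; element-index = λ { zero p → ⊥-elim (Bool.not-¬ P0 p) ; (suc x) p → cong suc (element-index x p) }
  }
  where open Enumeration E

Enumeration-via-involution : {P Q : Fin n → Bool} (f : Fin n → Fin n) → (∀ x → f (f x) ≡ x) →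
  (∀ x → Q x ≡ P (f x)) → Enumeration P a → Enumeration Q a
Enumeration-via-involution {P = P} {Q} f involutive Q≡P∘f E = record
  { element = f ∘ element
  ; index = λ x q → index (f x) (trans (sym (Q≡P∘f x)) q)
  ; element∈ = λ i → trans (Q≡P∘f _) (trans (cong P (involutive (element i))) (element∈ i))
  ; index-element = λ i → trans (index-cong (involutive (element i)) _ (element∈ i)) (index-element i)
  ; element-index = λ x q → trans (cong f (element-index (f x) _)) (involutive x)
  }
  where open Enumeration E

count-injective : (P : Fin m → Bool) (Q : Fin n → Bool) (f : ∀ x → P x ≡ true → Fin n) →
  (∀ x p → Q (f x p) ≡ true) →
  (∀ x y p q → f x p ≡ f y q → x ≡ y) →
  count P ≤ count Q
count-injective {n = n} P Q f maps injective = injective⇒≤ {f = g} g-injective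
  where
  module EP = Enumeration (enumerate P)
  module EQ = Enumeration (enumerate Q)
  f′ : Fin (count P) → Fin n
  f′ i = f (EP.element i) (EP.element∈ i)
  g : Fin (count P) → Fin (count Q)
  g i = EQ.index (f′ i) (maps _ _)
  g-injective : ∀ {i j} → g i ≡ g j → i ≡ j
  g-injective {i} {j} eq = EP.element-injective (injective _ _ _ _ (EQ.index-injective eq))

count-mono : {P Q : Fin n → Bool} → P ⊆ Q → count P ≤ count Q
count-mono {P = P} {Q} P⊆Q = count-injective P Q (λ x _ → x) P⊆Q (λ _ _ _ _ eq → eq)

⊆-antisym : {P Q : Fin n → Bool} → P ⊆ Q → Q ⊆ P → ∀ x → P x ≡ Q x
⊆-antisym {P = P} {Q} P⊆Q Q⊆P x with P x in px | Q x in qx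
... | true  | true  = refl
... | false | false = refl
... | true  | false = trans (sym (P⊆Q x px)) qx
... | false | true  = trans (sym px) (Q⊆P x qx)

count-∨ : (P Q : Fin n → Bool) → count (λ x → P x ∨ Q x) ≤ count P + count Q
count-∨ P Q = begin
  count (λ x → P x ∨ Q x)                             ≡⟨ count-cong (λ x → sym (∨-∧-not (P x) (Q x))) ⟩
  count (λ x → P x ∨ (Q x ∧ not (P x)))               ≡⟨ count-∨-disjoint P _ disjoint ⟩
  count P + count (λ x → Q x ∧ not (P x))             ≤⟨ +-monoʳ-≤ (count P) (count-mono Q∧¬P⊆Q) ⟩
  count P + count Q                                   ∎
  where
  open ≤-Reasoning
  ∨-∧-not : ∀ p q → p ∨ (q ∧ not p) ≡ p ∨ q
  ∨-∧-not true  q = refl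
  ∨-∧-not false q = Bool.∧-identityʳ q
  disjoint : ∀ x → P x ≡ true → Q x ∧ not (P x) ≡ false
  disjoint x px rewrite px = Bool.∧-zeroʳ (Q x)
  Q∧¬P⊆Q : (λ x → Q x ∧ not (P x)) ⊆ Q
  Q∧¬P⊆Q x = Bool.∧-conicalˡ (Q x) (not (P x))

count<count⇒∃ : (P Q : Fin n → Bool) → count P < count Q → ∃ λ x → Q x ≡ true × P x ≡ false
count<count⇒∃ P Q P<Q with any? (λ x → Q x Bool.≟ true ×-dec P x Bool.≟ false)
... | yes witness = witness
... | no none = contradiction (count-mono Q⊆P) (<⇒≱ P<Q)
  where
  Q⊆P : Q ⊆ P
  Q⊆P x qx with P x in px
  ... | true  = refl
  ... | false = contradiction (x , qx , px) none

0<count⇒∃ : (P : Fin n → Bool) → 0 < count P → ∃ λ x → P x ≡ true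
0<count⇒∃ {n} P 0<P
  with x , px , _ ← count<count⇒∃ (λ _ → false) P (subst (_< count P) (sym (count-const-false {n})) 0<P) = x , px

count-≤⇒⊇ : (P Q : Fin n → Bool) → P ⊆ Q → count Q ≤ count P → Q ⊆ P
count-≤⇒⊇ P Q P⊆Q Q≤P x qx with P x in px
... | true  = refl
... | false = contradiction Q≤P (<⇒≱ P<Q)
  where
  P∨x : Fin _ → Bool
  P∨x y = P y ∨ does (y ≟ x)
  disjoint : ∀ y → P y ≡ true → does (y ≟ x) ≡ false
  disjoint y py = dec-false (y ≟ x) λ { refl → Bool.not-¬ py px }
  P∨x⊆Q : P∨x ⊆ Q
  P∨x⊆Q y p with ∨-true⁻ {P y} p
  ... | inj₁ py = P⊆Q y py
  ... | inj₂ y≡x rewrite does-true⁻ (y ≟ x) y≡x = qx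
  P<Q : count P < count Q
  P<Q = begin-strict
    count P                               <⟨ m<m+n (count P) (s≤s z≤n) ⟩
    count P + 1                           ≡⟨ cong (count P +_) (count-singleton x) ⟨
    count P + count (λ y → does (y ≟ x))  ≡⟨ count-∨-disjoint P _ disjoint ⟨
    count P∨x                             ≤⟨ count-mono P∨x⊆Q ⟩
    count Q                               ∎
    where open ≤-Reasoning

count≡1⇒unique : (P : Fin n → Bool) → count P ≡ 1 → ∀ {x y} → P x ≡ true → P y ≡ true → x ≡ y
count≡1⇒unique P P≡1 {x} {y} px py with x ≟ y
... | yes x≡y = x≡y
... | no  x≢y = contradiction (begin
    2                                                  ≡⟨ cong₂ _+_ (count-singleton x) (count-singleton y) ⟨
    count (λ z → does (z ≟ x)) + count (λ z → does (z ≟ y)) ≡⟨ count-∨-disjoint _ _ disjoint ⟨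
    count (λ z → does (z ≟ x) ∨ does (z ≟ y))         ≤⟨ count-mono pair⊆P ⟩
    count P                                            ≡⟨ P≡1 ⟩
    1                                                  ∎) λ { (s≤s ()) }
  where
  open ≤-Reasoning
  disjoint : ∀ z → does (z ≟ x) ≡ true → does (z ≟ y) ≡ false
  disjoint z z≡x = dec-false (z ≟ y) λ z≡y → x≢y (trans (sym (does-true⁻ (z ≟ x) z≡x)) z≡y)
  pair⊆P : (λ z → does (z ≟ x) ∨ does (z ≟ y)) ⊆ P
  pair⊆P z p with ∨-true⁻ {does (z ≟ x)} p
  ... | inj₁ z≡x rewrite does-true⁻ (z ≟ x) z≡x = px
  ... | inj₂ z≡y rewrite does-true⁻ (z ≟ y) z≡y = py

length-filterᵇ-tabulate : ∀ {A : Set} (P : A → Bool) (f : Fin n → A) →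
  length (filterᵇ P (tabulate f)) ≡ count (P ∘ f)
length-filterᵇ-tabulate {zero}  P f = refl
length-filterᵇ-tabulate {suc n} P f with P (f zero)
... | true  = cong suc (length-filterᵇ-tabulate P (f ∘ suc))
... | false = length-filterᵇ-tabulate P (f ∘ suc)

count-remove : (P : Fin n → Bool) {x : Fin n} → P x ≡ true → count P ≡ suc (count (λ z → P z ∧ not (does (z ≟ x))))
count-remove P {x} px = begin
  count P                                        ≡⟨ count-split P (λ z → does (z ≟ x)) ⟩
  count (λ z → P z ∧ does (z ≟ x)) + rest        ≡⟨ cong (_+ rest) (count-cong only-x) ⟩
  count (λ z → does (z ≟ x)) + rest              ≡⟨ cong (_+ rest) (count-singleton x) ⟩
  suc rest                                       ∎
  where
  open ≡-Reasoning
  rest : ℕ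
  rest = count (λ z → P z ∧ not (does (z ≟ x)))
  only-x : ∀ z → P z ∧ does (z ≟ x) ≡ does (z ≟ x)
  only-x z with z ≟ x
  ... | yes refl = trans (Bool.∧-identityʳ (P z)) px
  ... | no  _    = Bool.∧-zeroʳ (P z)

module _ {n} (Γ : Graph n) where

  count-neighbours : ∀ {r} → Regular Γ r → ∀ x → count (adj Γ x) ≡ r
  count-neighbours regular x = trans (sym (length-filterᵇ-tabulate (adj Γ x) id)) (regular x)

  connected⇒closed-everywhere : Connected Γ → (C : Fin n → Set) →
    (∀ {x y} → C x → Adj Γ x y → C y) → ∀ {u} → C u → ∀ y → C y
  connected⇒closed-everywhere connected C closed {u} Cu y = along (proj₂ (connected u y)) Cu
    where
    along : ∀ {k x y} → Walk Γ k x y → C x → C y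
    along here        Cx = Cx
    along (there e w) Cx = along w (closed Cx e)

  ProperColouring : (Fin n → Bool) → Set
  ProperColouring c = ∀ x y → Adj Γ x y → c x ≢ c y

  commonNeighbours : Fin n → Fin n → ℕ
  commonNeighbours x y = count (λ v → adj Γ x v ∧ adj Γ y v)

  commonNeighbours-aut : ∀ {g} → IsAut Γ g → ∀ x y →
    commonNeighbours (g ⟨$⟩ʳ x) (g ⟨$⟩ʳ y) ≡ commonNeighbours x y
  commonNeighbours-aut {g} aut x y = begin
    count (λ v → adj Γ (g ⟨$⟩ʳ x) v ∧ adj Γ (g ⟨$⟩ʳ y) v)
      ≡⟨ count-permute _ g ⟨
    count (λ v → adj Γ (g ⟨$⟩ʳ x) (g ⟨$⟩ʳ v) ∧ adj Γ (g ⟨$⟩ʳ y) (g ⟨$⟩ʳ v))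
      ≡⟨ count-cong (λ v → cong₂ _∧_ (aut x v) (aut y v)) ⟩
    count (λ v → adj Γ x v ∧ adj Γ y v)
      ∎
    where open ≡-Reasoning

  -- In a bipartite graph, Γ₂ y z holds exactly when d(y, z) = 2.
  Γ₂ : Fin n → Fin n → Bool
  Γ₂ y z = not (does (z ≟ y)) ∧ does (any? λ v → adj Γ y v ∧ adj Γ v z Bool.≟ true)

  Γ₂-via : ∀ {y z v} → Adj Γ y v → Adj Γ v z → Γ₂ y z ≡ not (does (z ≟ y))
  Γ₂-via {y} {z} {v} yv vz =
    trans (cong (not (does (z ≟ y)) ∧_) (dec-true (any? _) (v , cong₂ _∧_ yv vz))) (Bool.∧-identityʳ _)

  Γ₂-intro : ∀ {y z v} → y ≢ z → Adj Γ y v → Adj Γ v z → Γ₂ y z ≡ true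
  Γ₂-intro {y} {z} y≢z yv vz = trans (Γ₂-via yv vz) (cong not (dec-false (z ≟ y) (y≢z ∘ sym)))

  Γ₂-elim : ∀ {y z} → Γ₂ y z ≡ true → y ≢ z × ∃ λ v → Adj Γ y v × Adj Γ v z
  Γ₂-elim {y} {z} p = y≢z , v , Bool.∧-conicalˡ _ _ yvz , Bool.∧-conicalʳ _ _ yvz
    where
    y≢z : y ≢ z
    y≢z y≡z = Bool.not-¬ (dec-true (z ≟ y) (sym y≡z)) (Bool.not-injective (Bool.∧-conicalˡ _ _ p))
    common : ∃ λ v → adj Γ y v ∧ adj Γ v z ≡ true
    common = does-true⁻ (any? λ v → adj Γ y v ∧ adj Γ v z Bool.≟ true) (Bool.∧-conicalʳ _ _ p)
    v : Fin n
    v = proj₁ common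
    yvz : adj Γ y v ∧ adj Γ v z ≡ true
    yvz = proj₂ common

  module _ {c : Fin n → Bool} (proper : ProperColouring c) where

    path²⇒sameColour : ∀ {x v y} → Adj Γ x v → Adj Γ v y → c x ≡ c y
    path²⇒sameColour {x} {v} {y} xv vy =
      trans (Bool.¬-not (proper x v xv)) (sym (Bool.¬-not (λ eq → proper v y vy (sym eq))))

    sameColour⇒¬adj : ∀ {x y} → c x ≡ c y → adj Γ x y ≡ false
    sameColour⇒¬adj {x} {y} eq with adj Γ x y in xy
    ... | true  = contradiction eq (proper x y xy)
    ... | false = refl

    adj⇒oppositeColour : ∀ {x y} → Adj Γ x y → (c x xor c y) ≡ true
    adj⇒oppositeColour {x} {y} xy = trans (cong (_xor c y) (Bool.¬-not (proper x y xy))) (Bool.xor-inverseˡ (c y))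

    Γ₂⇒Dist2 : ∀ {y z} → Γ₂ y z ≡ true → Dist Γ 2 y z
    Γ₂⇒Dist2 {y} {z} p with y≢z , v , yv , vz ← Γ₂-elim p = there yv (there vz here) , shorter
      where
      shorter : ∀ m → m < 2 → ¬ Walk Γ m y z
      shorter zero          _ here             = y≢z refl
      shorter (suc zero)    _ (there yz here) = Bool.not-¬ yz (sameColour⇒¬adj (path²⇒sameColour yv vz))
      shorter (suc (suc m)) (s≤s (s≤s ())) _

isLeft : ∀ {A B : Set} → A ⊎ B → Bool
isLeft = [ const true , const false ]′

Kmm-adj : ∀ s (a b : Fin (s + s)) → adj (Kmm s) a b ≡ isLeft (splitAt s a) xor isLeft (splitAt s b)
Kmm-adj s a b with splitAt s a | splitAt s b
... | inj₁ _ | inj₁ _ = refl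
... | inj₁ _ | inj₂ _ = refl
... | inj₂ _ | inj₁ _ = refl
... | inj₂ _ | inj₂ _ = refl

KminusMatching-adj : ∀ s (a b : Fin (s + s)) → adj (KminusMatching s) a b ≡
  (isLeft (splitAt s a) xor isLeft (splitAt s b)) ∧ not (does (reduce (splitAt s a) ≟ reduce (splitAt s b)))
KminusMatching-adj s a b with splitAt s a | splitAt s b
... | inj₁ _ | inj₁ _ = refl
... | inj₁ _ | inj₂ _ = refl
... | inj₂ _ | inj₁ _ = refl
... | inj₂ _ | inj₂ _ = refl

module ColourClassIso {n} (c : Fin n → Bool) (E₀ : Enumeration c s) (E₁ : Enumeration (not ∘ c) s) where
  private
    module E₀ = Enumeration E₀
    module E₁ = Enumeration E₁

  sideOf : ∀ x b → c x ≡ b → Fin s ⊎ Fin s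
  sideOf x true  cx = inj₁ (E₀.index x cx)
  sideOf x false cx = inj₂ (E₁.index x (cong not cx))

  side : Fin n → Fin s ⊎ Fin s
  side x = sideOf x (c x) refl

  side-true : ∀ {x} (p : c x ≡ true) → side x ≡ inj₁ (E₀.index x p)
  side-true {x} = sideOf-true (c x) refl
    where
    sideOf-true : ∀ b (cx : c x ≡ b) (p : c x ≡ true) → sideOf x b cx ≡ inj₁ (E₀.index x p)
    sideOf-true true  _  _ = refl
    sideOf-true false cx p = contradiction (trans (sym p) cx) λ ()

  side-false : ∀ {x} (p : not (c x) ≡ true) → side x ≡ inj₂ (E₁.index x p)
  side-false {x} = sideOf-false (c x) refl
    where
    sideOf-false : ∀ b (cx : c x ≡ b) (p : not (c x) ≡ true) → sideOf x b cx ≡ inj₂ (E₁.index x p)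
    sideOf-false false _  _ = refl
    sideOf-false true  cx p = contradiction (trans (sym p) (cong not cx)) λ ()

  isLeft-side : ∀ x → isLeft (side x) ≡ c x
  isLeft-side x = isLeft-sideOf (c x) refl
    where
    isLeft-sideOf : ∀ b (cx : c x ≡ b) → isLeft (sideOf x b cx) ≡ b
    isLeft-sideOf true  _ = refl
    isLeft-sideOf false _ = refl

  unside : Fin s ⊎ Fin s → Fin n
  unside = [ E₀.element , E₁.element ]′

  unside-side : ∀ x → unside (side x) ≡ x
  unside-side x = unside-sideOf (c x) refl
    where
    unside-sideOf : ∀ b (cx : c x ≡ b) → unside (sideOf x b cx) ≡ x
    unside-sideOf true  cx = E₀.element-index x cx
    unside-sideOf false cx = E₁.element-index x (cong not cx)

  side-unside : ∀ i → side (unside i) ≡ i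
  side-unside (inj₁ i) = trans (side-true (E₀.element∈ i)) (cong inj₁ (E₀.index-element i))
  side-unside (inj₂ i) = trans (side-false (E₁.element∈ i)) (cong inj₂ (E₁.index-element i))

  iso : Fin n ↔ Fin (s + s)
  iso = mk↔ₛ′ (join s s ∘ side) (unside ∘ splitAt s)
    (λ k → trans (cong (join s s) (side-unside (splitAt s k))) (join-splitAt s s k))
    (λ x → trans (cong unside (splitAt-join s s (side x))) (unside-side x))

  splitAt-iso : ∀ x → splitAt s (Inverse.to iso x) ≡ side x
  splitAt-iso x = splitAt-join s s (side x)

module _ {n} (Γ : Graph n) {r} (regular : Regular Γ r) {c : Fin n → Bool} (proper : ProperColouring Γ c) where

  opposite : Fin n → Fin n → Bool
  opposite x y = c x xor c y

  neighbours⊆opposite : ∀ x → adj Γ x ⊆ opposite x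
  neighbours⊆opposite x y = adj⇒oppositeColour Γ proper

  -- Count the edges: each has exactly one end of colour true.
  colourClasses-equal : .{{NonZero r}} → count c ≡ count (not ∘ c)
  colourClasses-equal = *-cancelʳ-≡ _ _ r (count-double (λ x y → c x ∧ adj Γ x y) c (not ∘ c) rows columns)
    where
    rows : ∀ x → count (λ y → c x ∧ adj Γ x y) ≡ (if c x then r else 0)
    rows x with c x
    ... | true  = count-neighbours Γ regular x
    ... | false = count-const-false {n}
    columns : ∀ y → count (λ x → c x ∧ adj Γ x y) ≡ (if not (c y) then r else 0)
    columns y with c y in cy
    ... | true  = trans (count-cong none) (count-const-false {n})
      where
      none : ∀ x → c x ∧ adj Γ x y ≡ false
      none x with c x in cx
      ... | true  = sameColour⇒¬adj Γ proper (trans cx (sym cy))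
      ... | false = refl
    ... | false = trans (count-cong all) (count-neighbours Γ regular y)
      where
      all : ∀ x → c x ∧ adj Γ x y ≡ adj Γ y x
      all x with adj Γ x y in xy
      ... | true  = trans (cong (_∧ true) (trans (Bool.¬-not (proper x y xy)) (cong not cy)))
                          (sym (trans (adj-sym Γ y x) xy))
      ... | false = trans (Bool.∧-zeroʳ (c x)) (sym (trans (adj-sym Γ y x) xy))

  module _ .{{_ : NonZero r}} {m} (c≡m : count c ≡ m) where

    count-opposite : ∀ x → count (opposite x) ≡ m
    count-opposite x with c x
    ... | true  = trans (sym colourClasses-equal) c≡m
    ... | false = c≡m

    enumeration₀ : Enumeration c m
    enumeration₀ = subst (Enumeration c) c≡m (enumerate c)

    enumeration₁ : Enumeration (not ∘ c) m
    enumeration₁ = subst (Enumeration (not ∘ c)) (trans (sym colourClasses-equal) c≡m) (enumerate (not ∘ c))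

  regular⇒≅Kmm : .{{NonZero r}} → count c ≡ r → Γ ≅ Kmm r
  regular⇒≅Kmm c≡r = iso , λ x y → begin
    adj (Kmm r) (to x) (to y)
      ≡⟨ Kmm-adj r (to x) (to y) ⟩
    isLeft (splitAt r (to x)) xor isLeft (splitAt r (to y))
      ≡⟨ cong₂ (λ a b → isLeft a xor isLeft b) (splitAt-iso x) (splitAt-iso y) ⟩
    isLeft (side x) xor isLeft (side y)
      ≡⟨ cong₂ _xor_ (isLeft-side x) (isLeft-side y) ⟩
    opposite x y
      ≡⟨ ⊆-antisym (neighbours⊆opposite x) (opposite⊆neighbours x) y ⟨
    adj Γ x y
      ∎
    where
    open ≡-Reasoning
    open ColourClassIso c (enumeration₀ c≡r) (enumeration₁ c≡r)
    to : Fin n → Fin (r + r)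
    to = Inverse.to iso
    opposite⊆neighbours : ∀ x → opposite x ⊆ adj Γ x
    opposite⊆neighbours x = count-≤⇒⊇ (adj Γ x) (opposite x) (neighbours⊆opposite x)
      (≤-reflexive (trans (count-opposite c≡r x) (sym (count-neighbours Γ regular x))))

  module _ .{{_ : NonZero r}} (c≡1+r : count c ≡ suc r) where

    missing : Fin n → Fin n → Bool
    missing x y = opposite x y ∧ not (adj Γ x y)

    count-missing : ∀ x → count (missing x) ≡ 1
    count-missing x = +-cancelˡ-≡ r _ 1 (begin
      r + count (missing x)                                  ≡⟨ cong (_+ count (missing x)) (count-neighbours Γ regular x) ⟨
      count (adj Γ x) + count (missing x)                    ≡⟨ cong (_+ count (missing x)) (count-cong neighbours) ⟨
      count (λ y → opposite x y ∧ adj Γ x y) + count (missing x)  ≡⟨ count-split (opposite x) (adj Γ x) ⟨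
      count (opposite x)                                     ≡⟨ count-opposite c≡1+r x ⟩
      suc r                                                  ≡⟨ +-comm 1 r ⟩
      r + 1                                                  ∎)
      where
      open ≡-Reasoning
      neighbours : ∀ y → opposite x y ∧ adj Γ x y ≡ adj Γ x y
      neighbours y with adj Γ x y in xy
      ... | true  = trans (Bool.∧-identityʳ _) (neighbours⊆opposite x y xy)
      ... | false = Bool.∧-zeroʳ _

    mate-exists : ∀ x → ∃ λ y → missing x y ≡ true
    mate-exists x = 0<count⇒∃ (missing x) (subst (0 <_) (sym (count-missing x)) (s≤s z≤n))

    mate : Fin n → Fin n
    mate x = proj₁ (mate-exists x)

    mate-missing : ∀ x → missing x (mate x) ≡ true
    mate-missing x = proj₂ (mate-exists x)

    missing⇒≡mate : ∀ {x y} → missing x y ≡ true → y ≡ mate x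
    missing⇒≡mate {x} p = count≡1⇒unique (missing x) (count-missing x) p (mate-missing x)

    mate-involutive : ∀ x → mate (mate x) ≡ x
    mate-involutive x = sym (missing⇒≡mate (trans missing-sym (mate-missing x)))
      where
      missing-sym : missing (mate x) x ≡ missing x (mate x)
      missing-sym = cong₂ _∧_ (Bool.xor-comm (c (mate x)) (c x)) (cong not (adj-sym Γ (mate x) x))

    mate-colour : ∀ x → c (mate x) ≡ not (c x)
    mate-colour x = xor-true⇒≡not (Bool.∧-conicalˡ _ _ (mate-missing x))

    mate-¬adj : ∀ x → adj Γ x (mate x) ≡ false
    mate-¬adj x = Bool.not-injective (Bool.∧-conicalʳ _ _ (mate-missing x))

    adj≡opposite∧¬mate : ∀ x y → adj Γ x y ≡ opposite x y ∧ not (does (y ≟ mate x))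
    adj≡opposite∧¬mate x y with adj Γ x y in xy
    ... | true  = sym (cong₂ _∧_ (neighbours⊆opposite x y xy) (cong not (dec-false (y ≟ mate x) y≢mate)))
      where
      y≢mate : y ≢ mate x
      y≢mate y≡m = Bool.not-¬ xy (trans (cong (adj Γ x) y≡m) (mate-¬adj x))
    ... | false with opposite x y in o
    ...   | true  = sym (cong not (dec-true (y ≟ mate x) (missing⇒≡mate (cong₂ _∧_ o (cong not xy)))))
    ...   | false = refl

    E₀ : Enumeration c (suc r)
    E₀ = enumeration₀ c≡1+r

    module E₀ = Enumeration E₀

    -- Enumerating the colour-false class through mate gives every vertex the position of its mate.
    E₁ : Enumeration (not ∘ c) (suc r)
    E₁ = Enumeration-via-involution mate mate-involutive (λ x → sym (mate-colour x)) E₀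

    open ColourClassIso c E₀ E₁

    position : Fin n → Fin (suc r)
    position x = reduce (side x)

    mate-swap : ∀ {x y} → x ≡ mate y ⇔ y ≡ mate x
    mate-swap {x} {y} = mk⇔ (λ x≡m → trans (sym (mate-involutive y)) (cong mate (sym x≡m)))
                            (λ y≡m → trans (sym (mate-involutive x)) (cong mate (sym y≡m)))

    samePosition⇔mate : ∀ {x y} → opposite x y ≡ true → position x ≡ position y ⇔ y ≡ mate x
    samePosition⇔mate {x} {y} o = byColour (c x) refl
      where
      ≡-⇔ : ∀ {p p′ q q′ : Fin (suc r)} → p ≡ p′ → q ≡ q′ → p ≡ q ⇔ p′ ≡ q′
      ≡-⇔ refl refl = mk⇔ (λ eq → eq) (λ eq → eq)
      byColour : ∀ b → c x ≡ b → position x ≡ position y ⇔ y ≡ mate x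
      byColour true  cx =
        mate-swap ⇔-∘ (E₀.index-≡⇔ ⇔-∘ ≡-⇔ (cong reduce (side-true cx)) (cong reduce (side-false ¬cy)))
        where
        ¬cy : not (c y) ≡ true
        ¬cy = cong not (trans (xor-true⇒≡not o) (cong not cx))
      byColour false cx =
        ⇔-sym-≡ ⇔-∘ (E₀.index-≡⇔ ⇔-∘ ≡-⇔ (cong reduce (side-false ¬cx)) (cong reduce (side-true cy)))
        where
        ¬cx : not (c x) ≡ true
        ¬cx = cong not cx
        cy : c y ≡ true
        cy = trans (xor-true⇒≡not o) (cong not cx)
        ⇔-sym-≡ : mate x ≡ y ⇔ y ≡ mate x
        ⇔-sym-≡ = mk⇔ sym sym

    regular⇒≅KminusMatching : Γ ≅ KminusMatching (suc r)
    regular⇒≅KminusMatching = iso , λ x y → begin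
      adj (KminusMatching (suc r)) (to x) (to y)
        ≡⟨ KminusMatching-adj (suc r) (to x) (to y) ⟩
      (isLeft (splitAt (suc r) (to x)) xor isLeft (splitAt (suc r) (to y)))
        ∧ not (does (reduce (splitAt (suc r) (to x)) ≟ reduce (splitAt (suc r) (to y))))
        ≡⟨ cong₂ (λ a b → (isLeft a xor isLeft b) ∧ not (does (reduce a ≟ reduce b)))
                 (splitAt-iso x) (splitAt-iso y) ⟩
      (isLeft (side x) xor isLeft (side y)) ∧ not (does (position x ≟ position y))
        ≡⟨ cong (λ o → o ∧ not (does (position x ≟ position y))) (cong₂ _xor_ (isLeft-side x) (isLeft-side y)) ⟩
      opposite x y ∧ not (does (position x ≟ position y))
        ≡⟨ unmatched x y ⟩
      opposite x y ∧ not (does (y ≟ mate x))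
        ≡⟨ adj≡opposite∧¬mate x y ⟨
      adj Γ x y ∎
      where
      open ≡-Reasoning
      to : Fin n → Fin (suc r + suc r)
      to = Inverse.to iso
      unmatched : ∀ x y →
        opposite x y ∧ not (does (position x ≟ position y)) ≡ opposite x y ∧ not (does (y ≟ mate x))
      unmatched x y = byOpposite (opposite x y) refl
        where
        byOpposite : ∀ b → opposite x y ≡ b →
          b ∧ not (does (position x ≟ position y)) ≡ b ∧ not (does (y ≟ mate x))
        byOpposite true  o = cong not (does-⇔ (samePosition⇔mate o) (position x ≟ position y) (y ≟ mate x))
        byOpposite false _ = refl

module _ {n} {Γ : Graph n} (X : AutSubgroup Γ) where
  open AutSubgroup X

  ArcStabilisersTrivial : Fin n → Set
  ArcStabilisersTrivial y = ∀ g v → Mem g → g ⟨$⟩ʳ y ≡ y → Adj Γ y v → g ⟨$⟩ʳ v ≡ v → ∀ x → g ⟨$⟩ʳ x ≡ x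

  aut-inverse : ∀ {g} → Mem g → ∀ x y → adj Γ (g ⟨$⟩ˡ x) (g ⟨$⟩ˡ y) ≡ adj Γ x y
  aut-inverse g∈X = mem-aut (mem-inv g∈X)

  -- Conjugate by an element h of X with h u = y.
  arcStabilisersTrivial-everywhere : VertexTransitive Γ X → ∀ {u} → ArcStabilisersTrivial u →
    ∀ y → ArcStabilisersTrivial y
  arcStabilisersTrivial-everywhere transitive {u} trivial y g v g∈X gy yv gv x = conjugate (transitive u y)
    where
    conjugate : (Σ (Permutation′ n) λ h → Mem h × h ⟨$⟩ʳ u ≡ y) → g ⟨$⟩ʳ x ≡ x
    conjugate (h , h∈X , hu) = begin
      g ⟨$⟩ʳ x                                       ≡⟨ inverseʳ h ⟨
      h ⟨$⟩ʳ (h ⟨$⟩ˡ (g ⟨$⟩ʳ x))                      ≡⟨ cong (λ t → h ⟨$⟩ʳ (h ⟨$⟩ˡ (g ⟨$⟩ʳ t))) (inverseʳ h) ⟨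
      h ⟨$⟩ʳ (h ⟨$⟩ˡ (g ⟨$⟩ʳ (h ⟨$⟩ʳ (h ⟨$⟩ˡ x))))    ≡⟨ cong (h ⟨$⟩ʳ_) (k-trivial (h ⟨$⟩ˡ x)) ⟩
      h ⟨$⟩ʳ (h ⟨$⟩ˡ x)                              ≡⟨ inverseʳ h ⟩
      x                                             ∎
      where
      open ≡-Reasoning
      k : Permutation′ n
      k = h ∘ₚ (g ∘ₚ flip h)
      ku : k ⟨$⟩ʳ u ≡ u
      ku = begin
        h ⟨$⟩ˡ (g ⟨$⟩ʳ (h ⟨$⟩ʳ u))  ≡⟨ cong (λ t → h ⟨$⟩ˡ (g ⟨$⟩ʳ t)) hu ⟩
        h ⟨$⟩ˡ (g ⟨$⟩ʳ y)           ≡⟨ cong (h ⟨$⟩ˡ_) (trans gy (sym hu)) ⟩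
        h ⟨$⟩ˡ (h ⟨$⟩ʳ u)           ≡⟨ inverseˡ h ⟩
        u                          ∎
      uv′ : Adj Γ u (h ⟨$⟩ˡ v)
      uv′ = begin
        adj Γ u (h ⟨$⟩ˡ v)                   ≡⟨ cong (λ t → adj Γ t (h ⟨$⟩ˡ v)) (inverseˡ h) ⟨
        adj Γ (h ⟨$⟩ˡ (h ⟨$⟩ʳ u)) (h ⟨$⟩ˡ v)  ≡⟨ aut-inverse h∈X (h ⟨$⟩ʳ u) v ⟩
        adj Γ (h ⟨$⟩ʳ u) v                   ≡⟨ cong (λ t → adj Γ t v) hu ⟩
        adj Γ y v                           ≡⟨ yv ⟩
        true                                ∎
      kv′ : k ⟨$⟩ʳ (h ⟨$⟩ˡ v) ≡ h ⟨$⟩ˡ v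
      kv′ = cong (h ⟨$⟩ˡ_) (trans (cong (g ⟨$⟩ʳ_) (inverseʳ h)) gv)
      k-trivial : ∀ z → k ⟨$⟩ʳ z ≡ z
      k-trivial = trivial k (h ⟨$⟩ˡ v) (mem-∘ h∈X (mem-∘ g∈X (mem-inv h∈X))) ku uv′ kv′

  arcStabilisersTrivial⇒agree : ∀ {y v g g′} → ArcStabilisersTrivial y → Mem g → Mem g′ →
    g ⟨$⟩ʳ y ≡ g′ ⟨$⟩ʳ y → Adj Γ y v → g ⟨$⟩ʳ v ≡ g′ ⟨$⟩ʳ v → ∀ z → g ⟨$⟩ʳ z ≡ g′ ⟨$⟩ʳ z
  arcStabilisersTrivial⇒agree {y} {v} {g} {g′} trivial g∈X g′∈X gy yv gv z = begin
    g ⟨$⟩ʳ z                       ≡⟨ inverseʳ g′ ⟨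
    g′ ⟨$⟩ʳ (g′ ⟨$⟩ˡ (g ⟨$⟩ʳ z))    ≡⟨ cong (g′ ⟨$⟩ʳ_) (h-trivial z) ⟩
    g′ ⟨$⟩ʳ z                      ∎
    where
    open ≡-Reasoning
    fixes : ∀ {x} → g ⟨$⟩ʳ x ≡ g′ ⟨$⟩ʳ x → g′ ⟨$⟩ˡ (g ⟨$⟩ʳ x) ≡ x
    fixes eq = trans (cong (g′ ⟨$⟩ˡ_) eq) (inverseˡ g′)
    h-trivial : ∀ z → g′ ⟨$⟩ˡ (g ⟨$⟩ʳ z) ≡ z
    h-trivial = trivial (g ∘ₚ flip g′) v (mem-∘ g∈X (mem-inv g′∈X)) (fixes gy) yv (fixes gv)

  module _ {c : Fin n → Bool} (proper : ProperColouring Γ c) where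

    -- Fix w₀ ∈ Γ₂(y) and a common neighbour v₀ of y and w₀. Sending x ∈ Γ₂(y) to g v₀, for some g ∈ X_y
    -- with g w₀ = x, is injective into Γ(y) because X_{y v₀} = 1.
    Γ₂-bound : ∀ {y} → StabTransitiveAt Γ X 2 y → ArcStabilisersTrivial y → count (Γ₂ Γ y) ≤ count (adj Γ y)
    Γ₂-bound {y} transitive trivial with any? (λ w → Γ₂ Γ y w Bool.≟ true)
    ... | no  none = subst (_≤ count (adj Γ y)) (sym (count-none λ w w∈Γ₂ → none (w , w∈Γ₂))) z≤n
    ... | yes (w₀ , w₀∈Γ₂) = count-injective (Γ₂ Γ y) (adj Γ y) image image-adj image-injective
      where
      v₀ : Fin n
      v₀ = proj₁ (proj₂ (Γ₂-elim Γ w₀∈Γ₂))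
      yv₀ : Adj Γ y v₀
      yv₀ = proj₁ (proj₂ (proj₂ (Γ₂-elim Γ w₀∈Γ₂)))
      moving : ∀ x → Γ₂ Γ y x ≡ true → Σ (Permutation′ n) λ g → Mem g × g ⟨$⟩ʳ y ≡ y × g ⟨$⟩ʳ w₀ ≡ x
      moving x x∈Γ₂ = transitive w₀ x (Γ₂⇒Dist2 Γ proper w₀∈Γ₂) (Γ₂⇒Dist2 Γ proper x∈Γ₂)
      image : ∀ x → Γ₂ Γ y x ≡ true → Fin n
      image x x∈Γ₂ = proj₁ (moving x x∈Γ₂) ⟨$⟩ʳ v₀
      image-adj : ∀ x x∈Γ₂ → adj Γ y (image x x∈Γ₂) ≡ true
      image-adj x x∈Γ₂ with g , g∈X , gy , _ ← moving x x∈Γ₂ =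
        trans (cong (λ t → adj Γ t (g ⟨$⟩ʳ v₀)) (sym gy)) (trans (mem-aut g∈X y v₀) yv₀)
      image-injective : ∀ x x′ x∈Γ₂ x′∈Γ₂ → image x x∈Γ₂ ≡ image x′ x′∈Γ₂ → x ≡ x′
      image-injective x x′ x∈Γ₂ x′∈Γ₂ eq
        with g , g∈X , gy , gw₀ ← moving x x∈Γ₂ | g′ , g′∈X , g′y , g′w₀ ← moving x′ x′∈Γ₂ =
        trans (sym gw₀) (trans (arcStabilisersTrivial⇒agree trivial g∈X g′∈X (trans gy (sym g′y)) yv₀ eq w₀) g′w₀)

    commonNeighbours-constant : ∀ {u w w′} → StabTransitiveAt Γ X 2 u → Γ₂ Γ u w ≡ true → Γ₂ Γ u w′ ≡ true →
      commonNeighbours Γ u w ≡ commonNeighbours Γ u w′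
    commonNeighbours-constant {u} {w} {w′} transitive w∈Γ₂ w′∈Γ₂
      with g , g∈X , gu , gw ← transitive w w′ (Γ₂⇒Dist2 Γ proper w∈Γ₂) (Γ₂⇒Dist2 Γ proper w′∈Γ₂) =
      trans (sym (commonNeighbours-aut Γ {g} (mem-aut g∈X) u w)) (cong₂ (commonNeighbours Γ) gu gw)

product-cases : ∀ {a b} k → a * b ≡ suc (suc k) * suc k → a ≤ suc (suc k) → b ≤ suc (suc k) →
  (a ≡ suc k × b ≡ suc (suc k)) ⊎ (a ≡ suc (suc k) × b ≡ suc k)
product-cases {a} {b} k ab≡ a≤ b≤ with m≤n⇒m<n∨m≡n b≤
... | inj₂ refl = inj₁ (*-cancelʳ-≡ a (suc k) (suc (suc k)) (trans ab≡ (*-comm (suc (suc k)) (suc k))) , refl)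
... | inj₁ (s≤s b≤1+k) with m≤n⇒m<n∨m≡n b≤1+k
...   | inj₂ refl = inj₂ (*-cancelʳ-≡ a (suc (suc k)) (suc k) ab≡ , refl)
...   | inj₁ b<1+k = contradiction (begin-strict
        suc (suc k) * suc k  ≡⟨ ab≡ ⟨
        a * b                ≤⟨ *-mono-≤ a≤ (≤-pred b<1+k) ⟩
        suc (suc k) * k      <⟨ *-monoʳ-< (suc (suc k)) (n<1+n k) ⟩
        suc (suc k) * suc k  ∎) (<-irrefl refl)
  where open ≤-Reasoning

module Argument {n} {Γ : Graph n} {X : AutSubgroup Γ} (connected : Connected Γ)
  {c : Fin n → Bool} (proper : ProperColouring Γ c) {k} (regular : Regular Γ (3 + k))
  (dt : DistanceTransitive2 Γ X) {u} (trivial-at-u : ArcStabilisersTrivial X u) where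

  A : Fin n → Fin n → Bool
  A = adj Γ

  degree-3+k : ∀ x → count (A x) ≡ 3 + k
  degree-3+k = count-neighbours Γ regular

  Γ₂u : Fin n → Bool
  Γ₂u = Γ₂ Γ u

  Γ₂-bound-everywhere : ∀ y → count (Γ₂ Γ y) ≤ 3 + k
  Γ₂-bound-everywhere y = ≤-trans
    (Γ₂-bound X proper (proj₂ (proj₂ dt) y) (arcStabilisersTrivial-everywhere X (proj₁ dt) trivial-at-u y))
    (≤-reflexive (degree-3+k y))

  Γ₂u⇒≢u : ∀ {z} → Γ₂u z ≡ true → z ≢ u
  Γ₂u⇒≢u z∈Γ₂ z≡u = proj₁ (Γ₂-elim Γ z∈Γ₂) (sym z≡u)

  path²-from-u : ∀ {x y} → Adj Γ u x → Adj Γ x y → y ≡ u ⊎ Γ₂u y ≡ true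
  path²-from-u {x} {y} ux xy with u ≟ y
  ... | yes u≡y = inj₁ (sym u≡y)
  ... | no  u≢y = inj₂ (Γ₂-intro Γ u≢y ux xy)

  count-Γ₂u-neighbours : ∀ {v} → Adj Γ u v → count (λ z → A v z ∧ Γ₂u z) ≡ 2 + k
  count-Γ₂u-neighbours {v} uv = suc-injective (begin
    suc (count (λ z → A v z ∧ Γ₂u z))                 ≡⟨ cong suc (count-cong others) ⟨
    suc (count (λ z → A v z ∧ not (does (z ≟ u))))    ≡⟨ count-remove (A v) (trans (adj-sym Γ v u) uv) ⟨
    count (A v)                                       ≡⟨ degree-3+k v ⟩
    3 + k                                             ∎)
    where
    open ≡-Reasoning
    others : ∀ z → A v z ∧ not (does (z ≟ u)) ≡ A v z ∧ Γ₂u z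
    others z with A v z in vz
    ... | true  = sym (Γ₂-via Γ uv vz)
    ... | false = refl

  v₀-exists : ∃ λ v → Adj Γ u v
  v₀-exists = 0<count⇒∃ (A u) (subst (0 <_) (sym (degree-3+k u)) (s≤s z≤n))

  v₀ : Fin n
  v₀ = proj₁ v₀-exists

  uv₀ : Adj Γ u v₀
  uv₀ = proj₂ v₀-exists

  w₀-exists : ∃ λ w → A v₀ w ∧ Γ₂u w ≡ true
  w₀-exists = 0<count⇒∃ (λ z → A v₀ z ∧ Γ₂u z) (subst (0 <_) (sym (count-Γ₂u-neighbours uv₀)) (s≤s z≤n))

  w₀ : Fin n
  w₀ = proj₁ w₀-exists

  w₀∈Γ₂u : Γ₂u w₀ ≡ true
  w₀∈Γ₂u = Bool.∧-conicalʳ (A v₀ w₀) _ (proj₂ w₀-exists)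

  c₀ : ℕ
  c₀ = commonNeighbours Γ u w₀

  commonNeighbours≡c₀ : ∀ {w} → Γ₂u w ≡ true → commonNeighbours Γ u w ≡ c₀
  commonNeighbours≡c₀ w∈Γ₂ = commonNeighbours-constant X proper (proj₂ (proj₂ dt) u) w∈Γ₂ w₀∈Γ₂u

  -- Double counting the edges between Γ(u) and Γ₂(u).
  Γ₂u-edges : count Γ₂u * c₀ ≡ (3 + k) * (2 + k)
  Γ₂u-edges = sym (trans (cong (_* (2 + k)) (sym (degree-3+k u)))
    (count-double (λ v z → A u v ∧ (A v z ∧ Γ₂u z)) (A u) Γ₂u rows columns))
    where
    rows : ∀ v → count (λ z → A u v ∧ (A v z ∧ Γ₂u z)) ≡ (if A u v then 2 + k else 0)
    rows v with A u v in uv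
    ... | true  = count-Γ₂u-neighbours uv
    ... | false = count-const-false {n}
    columns : ∀ z → count (λ v → A u v ∧ (A v z ∧ Γ₂u z)) ≡ (if Γ₂u z then c₀ else 0)
    columns z with Γ₂u z in z∈Γ₂
    ... | true  = trans (count-cong λ v → cong (A u v ∧_) (trans (Bool.∧-identityʳ _) (adj-sym Γ v z)))
                        (commonNeighbours≡c₀ z∈Γ₂)
    ... | false = trans (count-cong λ v → trans (cong (A u v ∧_) (Bool.∧-zeroʳ _)) (Bool.∧-zeroʳ _))
                        (count-const-false {n})

  Γ₂u-cases : (count Γ₂u ≡ 2 + k × c₀ ≡ 3 + k) ⊎ (count Γ₂u ≡ 3 + k × c₀ ≡ 2 + k)
  Γ₂u-cases = product-cases (suc k) Γ₂u-edges (Γ₂-bound-everywhere u)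
    (≤-trans (count-mono {P = λ v → A u v ∧ A w₀ v} λ v → Bool.∧-conicalˡ _ _) (≤-reflexive (degree-3+k u)))

  colour : Fin n → Bool
  colour z = not (c u) xor c z

  colour-proper : ProperColouring Γ colour
  colour-proper x y xy eq = proper x y xy (xor-cancelˡ (not (c u)) eq)
    where
    xor-cancelˡ : ∀ b {p q} → b xor p ≡ b xor q → p ≡ q
    xor-cancelˡ true  = Bool.not-injective
    xor-cancelˡ false = λ eq → eq

  colour-u : colour u ≡ true
  colour-u = Bool.xor-inverseˡ (c u)

  Γ₂u⇒colour : ∀ {z} → Γ₂u z ≡ true → colour z ≡ true
  Γ₂u⇒colour z∈Γ₂ with _ , (_ , ux , xz) ← Γ₂-elim Γ z∈Γ₂ =
    trans (sym (path²⇒sameColour Γ colour-proper ux xz)) colour-u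

  adj⇒¬colour : ∀ {y z} → Adj Γ y z → colour y ≡ true → colour z ≡ false
  adj⇒¬colour {y} {z} yz y∈ = trans (Bool.¬-not (λ eq → colour-proper y z yz (sym eq))) (cong not y∈)

  colourClass-count : (∀ z → colour z ≡ true → z ≡ u ⊎ Γ₂u z ≡ true) → count colour ≡ suc (count Γ₂u)
  colourClass-count covered = begin
    count colour                             ≡⟨ count-cong (⊆-antisym colour⊆ ⊆colour) ⟩
    count (λ z → does (z ≟ u) ∨ Γ₂u z)       ≡⟨ count-∨-disjoint (λ z → does (z ≟ u)) Γ₂u disjoint ⟩
    count (λ z → does (z ≟ u)) + count Γ₂u   ≡⟨ cong (_+ count Γ₂u) (count-singleton u) ⟩
    suc (count Γ₂u)                          ∎
    where
    open ≡-Reasoning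
    colour⊆ : colour ⊆ (λ z → does (z ≟ u) ∨ Γ₂u z)
    colour⊆ z z∈ with covered z z∈
    ... | inj₁ z≡u  = cong (_∨ Γ₂u z) (dec-true (z ≟ u) z≡u)
    ... | inj₂ z∈Γ₂ = ∨-true⁺ʳ (does (z ≟ u)) z∈Γ₂
    ⊆colour : (λ z → does (z ≟ u) ∨ Γ₂u z) ⊆ colour
    ⊆colour z p with ∨-true⁻ {does (z ≟ u)} p
    ... | inj₁ z≟u  = subst (λ t → colour t ≡ true) (sym (does-true⁻ (z ≟ u) z≟u)) colour-u
    ... | inj₂ z∈Γ₂ = Γ₂u⇒colour z∈Γ₂
    disjoint : ∀ z → does (z ≟ u) ≡ true → Γ₂u z ≡ false
    disjoint z z≟u = Bool.¬-not λ z∈Γ₂ → Γ₂u⇒≢u z∈Γ₂ (does-true⁻ (z ≟ u) z≟u)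

  module CompleteCase (Γ₂u≡2+k : count Γ₂u ≡ 2 + k) (c₀≡3+k : c₀ ≡ 3 + k) where

    Γ₂u-sameNeighbours : ∀ {w} → Γ₂u w ≡ true → ∀ z → A w z ≡ A u z
    Γ₂u-sameNeighbours {w} w∈Γ₂ = ⊆-antisym Nw⊆Nu Nu⊆Nw
      where
      Nu⊆Nw : A u ⊆ A w
      Nu⊆Nw z uz = Bool.∧-conicalʳ (A u z) (A w z)
        (count-≤⇒⊇ (λ v → A u v ∧ A w v) (A u) (λ v → Bool.∧-conicalˡ _ _)
          (≤-reflexive (trans (degree-3+k u) (sym (trans (commonNeighbours≡c₀ w∈Γ₂) c₀≡3+k)))) z uz)
      Nw⊆Nu : A w ⊆ A u
      Nw⊆Nu = count-≤⇒⊇ (A u) (A w) Nu⊆Nw (≤-reflexive (trans (degree-3+k w) (sym (degree-3+k u))))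

    Near : Fin n → Set
    Near z = z ≡ u ⊎ Adj Γ u z ⊎ Γ₂u z ≡ true

    everywhere-near : ∀ z → Near z
    everywhere-near = connected⇒closed-everywhere Γ connected Near step (inj₁ refl)
      where
      step : ∀ {x y} → Near x → Adj Γ x y → Near y
      step (inj₁ refl)         xy = inj₂ (inj₁ xy)
      step (inj₂ (inj₁ ux))    xy = map₂ inj₂ (path²-from-u ux xy)
      step (inj₂ (inj₂ x∈Γ₂)) xy = inj₂ (inj₁ (trans (sym (Γ₂u-sameNeighbours x∈Γ₂ _)) xy))

    ≅Kmm : Γ ≅ Kmm (3 + k)
    ≅Kmm = regular⇒≅Kmm Γ regular colour-proper (trans (colourClass-count covered) (cong suc Γ₂u≡2+k))
      where
      covered : ∀ z → colour z ≡ true → z ≡ u ⊎ Γ₂u z ≡ true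
      covered z = colourClass (everywhere-near z)
        where
        colourClass : ∀ {z} → Near z → colour z ≡ true → z ≡ u ⊎ Γ₂u z ≡ true
        colourClass (inj₁ z≡u)         _  = inj₁ z≡u
        colourClass (inj₂ (inj₁ uz))   z∈ = contradiction (trans (sym z∈) (adj⇒¬colour uz colour-u)) λ ()
        colourClass (inj₂ (inj₂ z∈Γ₂)) _  = inj₂ z∈Γ₂

  module MatchingCase (Γ₂u≡3+k : count Γ₂u ≡ 3 + k) (c₀≡2+k : c₀ ≡ 2 + k) where

    complement-one : ∀ {P Q : Fin n → Bool} → count P ≡ 3 + k → count (λ z → P z ∧ Q z) ≡ 2 + k →
      count (λ z → P z ∧ not (Q z)) ≡ 1
    complement-one {P} {Q} P≡ P∧Q≡ = +-cancelˡ-≡ (2 + k) _ 1 (begin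
      2 + k + rest                      ≡⟨ cong (_+ rest) P∧Q≡ ⟨
      count (λ z → P z ∧ Q z) + rest    ≡⟨ count-split P Q ⟨
      count P                           ≡⟨ P≡ ⟩
      3 + k                             ≡⟨ +-comm 1 (2 + k) ⟩
      2 + k + 1                         ∎)
      where
      open ≡-Reasoning
      rest : ℕ
      rest = count (λ z → P z ∧ not (Q z))

    commonNeighbours-Γ₂u : ∀ {w} → Γ₂u w ≡ true → count (λ v → A u v ∧ A w v) ≡ 2 + k
    commonNeighbours-Γ₂u w∈Γ₂ = trans (commonNeighbours≡c₀ w∈Γ₂) c₀≡2+k

    one-missed : ∀ {w} → Γ₂u w ≡ true → count (λ v → A u v ∧ not (A w v)) ≡ 1
    one-missed w∈Γ₂ = complement-one (degree-3+k u) (commonNeighbours-Γ₂u w∈Γ₂)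

    one-outside : ∀ {w} → Γ₂u w ≡ true → count (λ z → A w z ∧ not (A u z)) ≡ 1
    one-outside {w} w∈Γ₂ = complement-one (degree-3+k w)
      (trans (count-cong λ z → Bool.∧-comm (A w z) (A u z)) (commonNeighbours-Γ₂u w∈Γ₂))

    -- Each of w and z misses only one neighbour of u, and u has 3 + k ≥ 3 neighbours.
    common-neighbour : ∀ {w z} → Γ₂u w ≡ true → Γ₂u z ≡ true → ∃ λ v → Adj Γ w v × Adj Γ v z
    common-neighbour {w} {z} w∈Γ₂ z∈Γ₂ = witness (count<count⇒∃ missedByOne (A u) fewer)
      where
      missedByOne : Fin n → Bool
      missedByOne v = A u v ∧ (not (A w v) ∨ not (A z v))
      fewer : count missedByOne < count (A u)
      fewer = begin-strict
        count missedByOne                                  ≡⟨ count-cong (λ v → Bool.∧-distribˡ-∨ (A u v) _ _) ⟩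
        count (λ v → missedBy w v ∨ missedBy z v)          ≤⟨ count-∨ (missedBy w) (missedBy z) ⟩
        count (missedBy w) + count (missedBy z)            ≡⟨ cong₂ _+_ (one-missed w∈Γ₂) (one-missed z∈Γ₂) ⟩
        2                                                  <⟨ s≤s (s≤s (s≤s z≤n)) ⟩
        3 + k                                              ≡⟨ degree-3+k u ⟨
        count (A u)                                        ∎
        where
        open ≤-Reasoning
        missedBy : Fin n → Fin n → Bool
        missedBy w v = A u v ∧ not (A w v)
      witness : (∃ λ v → A u v ≡ true × missedByOne v ≡ false) → ∃ λ v → Adj Γ w v × Adj Γ v z
      witness (v , uv , v∉) =
        v , Bool.not-injective (Bool.∨-conicalˡ _ _ both)
          , trans (adj-sym Γ v z) (Bool.not-injective (Bool.∨-conicalʳ _ _ both))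
        where
        both : not (A w v) ∨ not (A z v) ≡ false
        both = trans (sym (cong (_∧ (not (A w v) ∨ not (A z v))) uv)) v∉

    -- {u} ∪ (Γ₂(u) ∖ {w}); by counting it is exactly Γ₂(w).
    others : Fin n → Fin n → Bool
    others w z = does (z ≟ u) ∨ (Γ₂u z ∧ not (does (z ≟ w)))

    count-others : ∀ {w} → Γ₂u w ≡ true → count (others w) ≡ 3 + k
    count-others {w} w∈Γ₂ = begin
      count (others w)                                    ≡⟨ count-∨-disjoint _ _ disjoint ⟩
      count (λ z → does (z ≟ u)) + count Γ₂u∖w            ≡⟨ cong₂ _+_ (count-singleton u) Γ₂u∖w≡ ⟩
      3 + k                                               ∎
      where
      open ≡-Reasoning
      Γ₂u∖w : Fin n → Bool
      Γ₂u∖w z = Γ₂u z ∧ not (does (z ≟ w))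
      Γ₂u∖w≡ : count Γ₂u∖w ≡ 2 + k
      Γ₂u∖w≡ = suc-injective (trans (sym (count-remove Γ₂u w∈Γ₂)) Γ₂u≡3+k)
      disjoint : ∀ z → does (z ≟ u) ≡ true → Γ₂u z ∧ not (does (z ≟ w)) ≡ false
      disjoint z z≟u = cong (_∧ not (does (z ≟ w))) (Bool.¬-not λ z∈Γ₂ → Γ₂u⇒≢u z∈Γ₂ (does-true⁻ (z ≟ u) z≟u))

    others⊆Γ₂ : ∀ {w} → Γ₂u w ≡ true → others w ⊆ Γ₂ Γ w
    others⊆Γ₂ {w} w∈Γ₂ z p with ∨-true⁻ {does (z ≟ u)} p
    ... | inj₁ z≟u rewrite does-true⁻ (z ≟ u) z≟u =
      let v , uvw = 0<count⇒∃ (λ v → A u v ∧ A w v) (subst (0 <_) (sym (commonNeighbours-Γ₂u w∈Γ₂)) (s≤s z≤n))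
      in Γ₂-intro Γ (Γ₂u⇒≢u w∈Γ₂) (Bool.∧-conicalʳ _ _ uvw) (trans (adj-sym Γ v u) (Bool.∧-conicalˡ _ _ uvw))
    ... | inj₂ q =
      let z∈Γ₂ = Bool.∧-conicalˡ _ _ q
          v , wv , vz = common-neighbour w∈Γ₂ z∈Γ₂
          w≢z w≡z = Bool.not-¬ (dec-true (z ≟ w) (sym w≡z)) (Bool.not-injective (Bool.∧-conicalʳ _ _ q))
      in Γ₂-intro Γ w≢z wv vz

    Γ₂⊆others : ∀ {w} → Γ₂u w ≡ true → Γ₂ Γ w ⊆ others w
    Γ₂⊆others {w} w∈Γ₂ = count-≤⇒⊇ (others w) (Γ₂ Γ w) (others⊆Γ₂ w∈Γ₂)
      (≤-trans (Γ₂-bound-everywhere w) (≤-reflexive (sym (count-others w∈Γ₂))))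

    outside-neighbourhood : ∀ {w x} → Γ₂u w ≡ true → Adj Γ w x → A u x ≡ false → ∀ y → A x y ≡ Γ₂u y
    outside-neighbourhood {w} {x} w∈Γ₂ wx ux = ⊆-antisym Nx⊆Γ₂u
      (count-≤⇒⊇ (A x) Γ₂u Nx⊆Γ₂u (≤-reflexive (trans Γ₂u≡3+k (sym (degree-3+k x)))))
      where
      Nx⊆Γ₂u : A x ⊆ Γ₂u
      Nx⊆Γ₂u y xy with w ≟ y
      ... | yes refl = w∈Γ₂
      ... | no  w≢y with ∨-true⁻ {does (y ≟ u)} (Γ₂⊆others w∈Γ₂ y (Γ₂-intro Γ w≢y wx xy))
      ...   | inj₁ y≟u rewrite does-true⁻ (y ≟ u) y≟u =
        contradiction (trans (sym (trans (adj-sym Γ x u) ux)) xy) λ ()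
      ...   | inj₂ q = Bool.∧-conicalˡ _ _ q

    ξ-exists : ∃ λ x → A w₀ x ∧ not (A u x) ≡ true
    ξ-exists = 0<count⇒∃ (λ x → A w₀ x ∧ not (A u x)) (subst (0 <_) (sym (one-outside w₀∈Γ₂u)) (s≤s z≤n))

    ξ : Fin n
    ξ = proj₁ ξ-exists

    w₀ξ : Adj Γ w₀ ξ
    w₀ξ = Bool.∧-conicalˡ _ _ (proj₂ ξ-exists)

    uξ : A u ξ ≡ false
    uξ = Bool.not-injective (Bool.∧-conicalʳ (A w₀ ξ) _ (proj₂ ξ-exists))

    ξ-neighbourhood : ∀ y → A ξ y ≡ Γ₂u y
    ξ-neighbourhood = outside-neighbourhood w₀∈Γ₂u w₀ξ uξ

    outside≡ξ : ∀ {w x} → Γ₂u w ≡ true → Adj Γ w x → A u x ≡ false → x ≡ ξ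
    outside≡ξ {w} w∈Γ₂ wx ux = count≡1⇒unique _ (one-outside w∈Γ₂)
      (cong₂ _∧_ wx (cong not ux))
      (cong₂ _∧_ (trans (adj-sym Γ w ξ) (trans (ξ-neighbourhood w) w∈Γ₂)) (cong not uξ))

    Near : Fin n → Set
    Near z = z ≡ u ⊎ Adj Γ u z ⊎ Γ₂u z ≡ true ⊎ z ≡ ξ

    everywhere-near : ∀ z → Near z
    everywhere-near = connected⇒closed-everywhere Γ connected Near step (inj₁ refl)
      where
      step : ∀ {x y} → Near x → Adj Γ x y → Near y
      step (inj₁ refl) xy = inj₂ (inj₁ xy)
      step (inj₂ (inj₁ ux)) xy = map₂ (inj₂ ∘ inj₁) (path²-from-u ux xy)
      step {y = y} (inj₂ (inj₂ (inj₁ x∈Γ₂))) xy = byAdjacency (A u y) refl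
        where
        byAdjacency : ∀ b → A u y ≡ b → Near y
        byAdjacency true  uy = inj₂ (inj₁ uy)
        byAdjacency false uy = inj₂ (inj₂ (inj₂ (outside≡ξ x∈Γ₂ xy uy)))
      step {y = y} (inj₂ (inj₂ (inj₂ x≡ξ))) xy =
        inj₂ (inj₂ (inj₁ (trans (sym (ξ-neighbourhood y)) (subst (λ t → Adj Γ t y) x≡ξ xy))))

    ≅KminusMatching : Γ ≅ KminusMatching (4 + k)
    ≅KminusMatching =
      regular⇒≅KminusMatching Γ regular colour-proper (trans (colourClass-count covered) (cong suc Γ₂u≡3+k))
      where
      covered : ∀ z → colour z ≡ true → z ≡ u ⊎ Γ₂u z ≡ true
      covered z = colourClass (everywhere-near z)
        where
        colourClass : ∀ {z} → Near z → colour z ≡ true → z ≡ u ⊎ Γ₂u z ≡ true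
        colourClass (inj₁ z≡u)                _  = inj₁ z≡u
        colourClass (inj₂ (inj₁ uz))          z∈ = contradiction (trans (sym z∈) (adj⇒¬colour uz colour-u)) λ ()
        colourClass (inj₂ (inj₂ (inj₁ z∈Γ₂))) _  = inj₂ z∈Γ₂
        colourClass (inj₂ (inj₂ (inj₂ z≡ξ)))  z∈ =
          contradiction (trans (sym z∈) (trans (cong colour z≡ξ) (adj⇒¬colour w₀ξ (Γ₂u⇒colour w₀∈Γ₂u)))) λ ()

  conclusion : (Γ ≅ Kmm (3 + k)) ⊎ (Γ ≅ KminusMatching (4 + k))
  conclusion = map (uncurry CompleteCase.≅Kmm) (uncurry MatchingCase.≅KminusMatching) Γ₂u-cases

lemma2p12 : (n r : ℕ) (Γ : Graph n) (X : AutSubgroup Γ) →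
    Connected Γ → Bipartite Γ → 3 ≤ r → Regular Γ r →
    DistanceTransitive2 Γ X →
    Σ (Fin n) (λ u → StabRegularOnNbhd Γ X u) →
    (Γ ≅ Kmm r) ⊎ (Γ ≅ KminusMatching (suc r))
lemma2p12 n r Γ X connected (c , proper) (s≤s (s≤s (s≤s _))) regular dt (u , _ , trivial-at-u) =
  Argument.conclusion {X = X} connected proper regular dt trivial-at-u
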